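{- For integers $h \geq 1$ and $r \geq 3$, let $n=r^h$ and let $c$ be any 2-coloring of $\mathcal{K}^r_n$ obtained from $c_{r,h}$ by replacing each occurrence of the color $0$ with $-$ or $+$ (independently for each edge). Then $c$ is an $r$-monotone coloring of $\mathcal{K}^r_n$.
   Context: $\mathcal{K}^r_n$ is the complete $r$-uniform hypergraph on $[n]=\{1,\dots,n\}$ with the natural order. A 2-coloring $c$ of its edges with values in $\{ -,+\}$ ($-<+$) is $r$-monotone if for every $v_1<\dots<v_{r+1}$, with $S^{(i)}$ the $r$-set obtained from $\{v_1,\dots,v_{r+1}\}$ by deleting $v_i$, the sequence $(c(S^{(r+1)}),\dots,c(S^{(1)}))$ changes sign at most once. A composition of $m$ into $k$ parts is a tuple $(p_1,\dots,p_k)$ of positive integers with sum $m$. The reduction step maps $(p_1,\dots,p_k)$ to $(p_1,\dots,p_k-1)$ if $p_k>1$ and to $(p_1,\dots,p_{k-1})$ if $p_k=1$. The reduction of a composition $\sigma$ is the (unique, if it exists) composition of the form $(1,\dots,1,2)$ or $(p,1)$ with $p>1$ obtained from $\sigma$ by a sequence of reduction steps; it exists iff $\sigma\ne(1,\dots,1)$ and $\sigma\ne(r)$. Signs of compositions of $r\ge3$ are defined recursively: for $r=3$, $(1,2)$ is negative and $(2,1)$ positive. For $r>3$, $\sigma$ is negative if its reduction is negative, or $\sigma=(1,\dots,1,2)$ with $r$ odd, or $\sigma=(r-1,1)$ with $r$ even; $\sigma$ is positive if its reduction is positive, or $\sigma=(1,\dots,1,2)$ with $r$ even, or $\sigma=(r-1,1)$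 with $r$ odd. The 3-coloring $c_{r,h}$ of $\mathcal{K}^r_{r^h}$ with colors $\{ -,0,+\}$: for $h=1$, the unique edge $[r]$ gets $0$. For $h\ge2$, let $n=r^h$, $m=r^{h-1}$, $V_i=\{(i-1)m+1,\dots,im\}$ for $i\in[r]$. For an edge $e$, let $e_1,\dots,e_k$ be the nonempty sets among $e\cap V_1,\dots,e\cap V_r$ in order, $p_i=|e_i|$, and $\sigma=(p_1,\dots,p_k)$. If $\sigma$ is negative, $c_{r,h}(e)=-$; if positive, $+$. If $\sigma=(r)$, i.e., $e=\{v_1,\dots,v_r\}\subseteq V_i$, then $c_{r,h}(e)=c_{r,h-1}(\{v_1-(i-1)m,\dots,v_r-(i-1)m\})$. If $\sigma=(1,\dots,1)$, then $v_i\in V_i$ for all $i$; put $v_i'=v_i-(i-1)m$ and set $c_{r,h}(e)=-$, $0$, or $+$ according as $\sum_{i\text{ even}}v_i'$ is $<$, $=$, or $>$ $\sum_{i\text{ odd}}v_i'$ (sums over $i\in[r]$). -}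

module Defs where

open import Data.Nat using (ℕ; zero; suc; _+_; _*_; _∸_; _^_; _≤_; _<_; _/_; _≡ᵇ_; _<ᵇ_)
open import Data.Bool using (Bool; true; false; if_then_else_; _∧_)
open import Data.List using (List; []; _∷_; map; length; upTo; filter; reverse)
open import Data.Nat.ListAction using (sum)
open import Data.Sum using (_⊎_)
open import Data.List.Relation.Unary.All using (All)
open import Data.List.Relation.Unary.Linked using (Linked)
open import Data.Maybe using (Maybe; just; nothing)
open import Data.Product using (_×_)
open import Relation.Binary.PropositionalEquality using (_≡_)
open import Relation.Nullary using (¬_)
open import Relation.Unary using (Decidable)

data Sign : Set where
  minus plus : Sign

data Col3 : Set where
  neg nul pos : Col3

-- Edges of K^r_n : an r-set {v₁ < … < v_r} ⊆ [n] is represented by the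
-- strictly increasing list v₁ ∷ … ∷ v_r ∷ [].

IsEdge : ℕ → ℕ → List ℕ → Set
IsEdge r n e = (length e ≡ r) × Linked _<_ e × All (λ v → 1 ≤ v × v ≤ n) e

isEven : ℕ → Bool
isEven zero = true
isEven (suc zero) = false
isEven (suc (suc n)) = isEven n

-- division that is total (the divisor is never 0 in our uses)
divN : ℕ → ℕ → ℕ
divN a zero = 0
divN a (suc d) = a / suc d

onesThenTwo : List ℕ → Bool
onesThenTwo (2 ∷ []) = true
onesThenTwo (1 ∷ xs) = onesThenTwo xs
onesThenTwo _ = false

isOnesTwo : List ℕ → Bool
isOnesTwo (1 ∷ xs) = onesThenTwo xs
isOnesTwo _ = false

isP1 : List ℕ → Bool
isP1 (suc (suc p) ∷ 1 ∷ []) = true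
isP1 _ = false

redStep : List ℕ → List ℕ
redStep [] = []
redStep (suc (suc p) ∷ []) = suc p ∷ []
redStep (_ ∷ []) = []
redStep (x ∷ y ∷ xs) = x ∷ redStep (y ∷ xs)

targetSign : List ℕ → Maybe Sign
targetSign σ =
  if isOnesTwo σ then just (if isEven (sum σ) then plus else minus)
  else if isP1 σ then just (if isEven (sum σ) then minus else plus)
  else nothing

-- the recursive definition: if σ is of reduced form use the direct rule,
-- otherwise σ has the same sign as redStep σ (which has the same reduction).
-- The fuel (sum of σ) bounds the number of reduction steps.
-- Result  nothing  means σ has no reduction (σ = (1,…,1) or σ = (r)).
signAux : ℕ → List ℕ → Maybe Sign
signAux zero σ = nothing
signAux (suc f) σ with targetSign σ
... | just s = just s
... | nothing = signAux f (redStep σ)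

compSign : List ℕ → Maybe Sign
compSign σ = signAux (sum σ) σ

allOnes : List ℕ → Bool
allOnes [] = true
allOnes (1 ∷ xs) = allOnes xs
allOnes _ = false

mutual
  oddPos : List ℕ → List ℕ     -- entries at positions 1,3,5,…
  oddPos [] = []
  oddPos (x ∷ xs) = x ∷ evenPos xs

  evenPos : List ℕ → List ℕ    -- entries at positions 2,4,6,…
  evenPos [] = []
  evenPos (x ∷ xs) = oddPos xs

embed : Sign → Col3
embed minus = neg
embed plus = pos

-- one level of the recursive construction: given r, k and the colouring
-- prev = c_{r,k+1} of K^r_{r^{k+1}}, this is c_{r,k+2} of K^r_{r^{k+2}}
-- (m = r^{k+1}, blocks V_i = {(i−1)m+1,…,im})
cStep : ℕ → ℕ → (List ℕ → Col3) → List ℕ → Col3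
cStep r k prev e = body
  where
  m : ℕ
  m = r ^ suc k
  -- 0-based index of the block V_{i+1} containing v
  blk : ℕ → ℕ
  blk v = divN (v ∸ 1) m
  cnt : ℕ → ℕ
  cnt i = sum (map (λ v → if blk v ≡ᵇ i then 1 else 0) e)
  -- the composition σ = (p₁,…,p_k) : sizes of nonempty e ∩ V_i in order
  σ : List ℕ
  σ = filter (λ p → Data.Nat._≤?_ 1 p) (map cnt (upTo r))
  shifted : List ℕ
  shifted = map (λ v → v ∸ blk v * m) e
  body : Col3
  body with length σ ≡ᵇ 1 | allOnes σ ∧ (length σ ≡ᵇ r)
  ... | true | _ = prev shifted          -- σ = (r) : recurse inside V_i
  ... | false | true =
    if sum (evenPos shifted) <ᵇ sum (oddPos shifted) then neg
    else if sum (evenPos shifted) ≡ᵇ sum (oddPos shifted) then nul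
    else pos
  ... | false | false with compSign σ
  ...   | just s = embed s
  ...   | nothing = nul   -- unreachable for r ≥ 3 (σ has a reduction)

cRH : ℕ → ℕ → List ℕ → Col3
cRH r zero e = nul                       -- unused (h ≥ 1)
cRH r (suc zero) e = nul                 -- h = 1 : the unique edge [r]
cRH r (suc (suc k)) = cStep r k (cRH r (suc k))

Completes : ℕ → ℕ → (List ℕ → Sign) → (List ℕ → Col3) → Set
Completes r n c c3 = ∀ e → IsEdge r n e → (c3 e ≡ nul) ⊎ (c3 e ≡ embed (c e))

-- [S⁽¹⁾, …, S⁽ᵏ⁾] : S⁽ⁱ⁾ = the list with its i-th entry deleted
deletions : List ℕ → List (List ℕ)
deletions [] = []
deletions (x ∷ xs) = xs ∷ map (x ∷_) (deletions xs)

signChanges : List Sign → ℕ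
signChanges (minus ∷ plus ∷ xs) = suc (signChanges (plus ∷ xs))
signChanges (plus ∷ minus ∷ xs) = suc (signChanges (minus ∷ xs))
signChanges (a ∷ b ∷ xs) = signChanges (b ∷ xs)
signChanges _ = 0

-- c is r-monotone on K^r_n: for every v₁ < … < v_{r+1} in [n], the
-- sequence (c(S⁽ʳ⁺¹⁾), …, c(S⁽¹⁾)) changes sign at most once
Monotone : ℕ → ℕ → (List ℕ → Sign) → Set
Monotone r n c = ∀ w → IsEdge (suc r) n w →
  signChanges (reverse (map c (deletions w))) ≤ 1

-- For an (r+1)-set w we show, by induction on h, that however the 0s among the
-- colours of its deletions S⁽¹⁾, …, S⁽ʳ⁺¹⁾ are resolved, the sequence changes sign
-- at most once (reversing it, as the definition does, changes nothing).  At level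
-- h+1 the sorted block indices of w have run lengths τ, the composition of w, and
-- the deletions have the compositions decs τ.  If w lies in one block its
-- deletions are coloured by level h.  Otherwise τ = (1,…,1,q,τ') with q ≥ 2, and a
-- closed form for the signs of compositions (closedSign) shows that the deletions
-- from the singleton blocks, from the q-block and from later blocks form three
-- constant runs whose middle sign agrees with a neighbour — except when q = 2 and
-- both deletions from the q-block leave one vertex per block: these get sum
-- colours, which never step back (sumColour-forward).

module Submission where

open import Defs
open import Data.Nat
open import Data.Nat.Properties
open import Data.Nat.DivMod
open import Data.Bool using (Bool; true; false; if_then_else_; not; _∧_; T)
open import Data.Unit using (tt)
open import Relation.Nullary using (Dec; yes; no; contradiction)
open import Data.List hiding (sum)
open import Data.List.Properties using (++-assoc; ++-identityʳ; unfold-reverse; length-++; length-replicate; length-map; length-filter; length-upTo; length-zipWith; map-id; map-++; map-∘; map-replicate; map-cong; map-cong-local; drop-map; zipWith-zeroʳ; zipWith-map; ∷-injectiveʳ)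
open import Data.List.Relation.Unary.Linked using (Linked; []; [-]; _∷_)
import Data.List.Relation.Unary.Linked as Lk
import Data.List.Relation.Unary.Linked.Properties as Lkₚ
open Lkₚ using (Linked⇒All)
import Data.List.Relation.Unary.All as All
open import Data.List.Relation.Unary.All using (All; []; _∷_)
open import Data.List.Relation.Unary.All.Properties using (++⁺; map⁺; replicate⁺)
open import Data.Sum using (_⊎_; inj₁; inj₂)
open import Data.Product using (Σ; _,_; _×_; proj₁; proj₂)
open import Data.Empty using (⊥; ⊥-elim)
open import Function using (_∘_)
open import Data.Maybe using (Maybe; just; nothing)
open import Data.Maybe.Properties using (just-injective)
open import Data.Nat.ListAction using (sum)
open import Relation.Binary.PropositionalEquality

flip : Sign → Sign
flip minus = plus
flip plus = minus

sign-dichotomy : ∀ (y s : Sign) → y ≡ s ⊎ y ≡ flip s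
sign-dichotomy minus minus = inj₁ refl
sign-dichotomy minus plus = inj₂ refl
sign-dichotomy plus minus = inj₂ refl
sign-dichotomy plus plus = inj₁ refl

change : Sign → Sign → ℕ
change minus plus = 1
change plus minus = 1
change _ _ = 0

change-refl : ∀ s → change s s ≡ 0
change-refl minus = refl
change-refl plus = refl

change-sym : ∀ a b → change a b ≡ change b a
change-sym minus minus = refl
change-sym minus plus = refl
change-sym plus minus = refl
change-sym plus plus = refl

change-≤1 : ∀ a b → change a b ≤ 1
change-≤1 minus minus = z≤n
change-≤1 minus plus = ≤-refl
change-≤1 plus minus = ≤-refl
change-≤1 plus plus = z≤n

signChanges-∷∷ : ∀ a b zs → signChanges (a ∷ b ∷ zs) ≡ change a b + signChanges (b ∷ zs)
signChanges-∷∷ minus minus zs = refl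
signChanges-∷∷ minus plus zs = refl
signChanges-∷∷ plus minus zs = refl
signChanges-∷∷ plus plus zs = refl

signChanges-[_] : ∀ a → signChanges (a ∷ []) ≡ 0
signChanges-[ minus ] = refl
signChanges-[ plus ] = refl

signChanges-split : ∀ xs b ys →
  signChanges (xs ++ b ∷ ys) ≡ signChanges (xs ++ b ∷ []) + signChanges (b ∷ ys)
signChanges-split [] b ys = cong (_+ signChanges (b ∷ ys)) (sym signChanges-[ b ])
signChanges-split (x ∷ []) b ys = begin
  signChanges (x ∷ b ∷ ys)                     ≡⟨ signChanges-∷∷ x b ys ⟩
  change x b + signChanges (b ∷ ys)            ≡⟨ cong (_+ signChanges (b ∷ ys)) (sym (+-identityʳ _)) ⟩
  change x b + 0 + signChanges (b ∷ ys)        ≡⟨ cong (λ k → change x b + k + signChanges (b ∷ ys)) (sym signChanges-[ b ]) ⟩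
  change x b + signChanges (b ∷ []) + signChanges (b ∷ ys)
                                               ≡⟨ cong (_+ signChanges (b ∷ ys)) (sym (signChanges-∷∷ x b [])) ⟩
  signChanges (x ∷ b ∷ []) + signChanges (b ∷ ys) ∎
  where open ≡-Reasoning
signChanges-split (x ∷ x' ∷ xs) b ys = begin
  signChanges (x ∷ x' ∷ xs ++ b ∷ ys)
    ≡⟨ signChanges-∷∷ x x' _ ⟩
  change x x' + signChanges (x' ∷ xs ++ b ∷ ys)
    ≡⟨ cong (change x x' +_) (signChanges-split (x' ∷ xs) b ys) ⟩
  change x x' + (signChanges (x' ∷ xs ++ b ∷ []) + signChanges (b ∷ ys))
    ≡⟨ sym (+-assoc (change x x') _ _) ⟩
  change x x' + signChanges (x' ∷ xs ++ b ∷ []) + signChanges (b ∷ ys)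
    ≡⟨ cong (_+ signChanges (b ∷ ys)) (sym (signChanges-∷∷ x x' _)) ⟩
  signChanges (x ∷ x' ∷ xs ++ b ∷ []) + signChanges (b ∷ ys) ∎
  where open ≡-Reasoning

signChanges-reverse : ∀ ys → signChanges (reverse ys) ≡ signChanges ys
signChanges-reverse [] = refl
signChanges-reverse (a ∷ []) = refl
signChanges-reverse (a ∷ b ∷ zs) = begin
  signChanges (reverse (a ∷ b ∷ zs))
    ≡⟨ cong signChanges reverse-∷∷ ⟩
  signChanges (reverse zs ++ b ∷ a ∷ [])
    ≡⟨ signChanges-split (reverse zs) b (a ∷ []) ⟩
  signChanges (reverse zs ++ b ∷ []) + signChanges (b ∷ a ∷ [])
    ≡⟨ cong₂ (λ u v → signChanges u + v) (sym (unfold-reverse b zs)) (signChanges-∷∷ b a []) ⟩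
  signChanges (reverse (b ∷ zs)) + (change b a + signChanges (a ∷ []))
    ≡⟨ cong₂ (λ u v → u + (change b a + v)) (signChanges-reverse (b ∷ zs)) signChanges-[ a ] ⟩
  signChanges (b ∷ zs) + (change b a + 0)
    ≡⟨ cong (signChanges (b ∷ zs) +_) (trans (+-identityʳ _) (change-sym b a)) ⟩
  signChanges (b ∷ zs) + change a b
    ≡⟨ +-comm _ (change a b) ⟩
  change a b + signChanges (b ∷ zs)
    ≡⟨ sym (signChanges-∷∷ a b zs) ⟩
  signChanges (a ∷ b ∷ zs) ∎
  where
  open ≡-Reasoning
  reverse-∷∷ : reverse (a ∷ b ∷ zs) ≡ reverse zs ++ b ∷ a ∷ []
  reverse-∷∷ = begin
    reverse (a ∷ b ∷ zs)             ≡⟨ unfold-reverse a (b ∷ zs) ⟩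
    reverse (b ∷ zs) ++ a ∷ []       ≡⟨ cong (_++ a ∷ []) (unfold-reverse b zs) ⟩
    (reverse zs ++ b ∷ []) ++ a ∷ [] ≡⟨ ++-assoc (reverse zs) (b ∷ []) (a ∷ []) ⟩
    reverse zs ++ b ∷ a ∷ []         ∎

signChanges-const : ∀ {s ys} → All (_≡ s) ys → signChanges ys ≡ 0
signChanges-const [] = refl
signChanges-const {s} (refl ∷ []) = signChanges-[ s ]
signChanges-const {s} (refl ∷ refl ∷ ps) =
  trans (signChanges-∷∷ s s _) (cong₂ _+_ (change-refl s) (signChanges-const (refl ∷ ps)))

signChanges-++ : ∀ xs ys → signChanges (xs ++ ys) ≤ signChanges xs + 1 + signChanges ys
signChanges-++ [] ys = n≤1+n _
signChanges-++ (x ∷ []) [] rewrite signChanges-[ x ] = z≤n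
signChanges-++ (x ∷ []) (y ∷ ys) rewrite signChanges-∷∷ x y ys | signChanges-[ x ] =
  +-monoˡ-≤ _ (change-≤1 x y)
signChanges-++ (x ∷ x' ∷ xs) ys = begin
  signChanges (x ∷ x' ∷ xs ++ ys)
    ≡⟨ signChanges-∷∷ x x' (xs ++ ys) ⟩
  change x x' + signChanges (x' ∷ xs ++ ys)
    ≤⟨ +-monoʳ-≤ (change x x') (signChanges-++ (x' ∷ xs) ys) ⟩
  change x x' + (signChanges (x' ∷ xs) + 1 + signChanges ys)
    ≡⟨ sym (trans (cong (λ k → k + 1 + signChanges ys) (signChanges-∷∷ x x' xs))
                  (trans (cong (_+ signChanges ys) (+-assoc (change x x') _ 1))
                         (+-assoc (change x x') _ (signChanges ys)))) ⟩
  signChanges (x ∷ x' ∷ xs) + 1 + signChanges ys ∎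
  where open ≤-Reasoning

two-runs : ∀ {s t xs ys} → All (_≡ s) xs → All (_≡ t) ys → signChanges (xs ++ ys) ≤ 1
two-runs {xs = xs} {ys} ps qs = begin
  signChanges (xs ++ ys)                         ≤⟨ signChanges-++ xs ys ⟩
  signChanges xs + 1 + signChanges ys            ≡⟨ cong₂ (λ u v → u + 1 + v) (signChanges-const ps) (signChanges-const qs) ⟩
  1                                              ∎
  where open ≤-Reasoning

three-runs : ∀ {s u t xs ys zs} → All (_≡ s) xs → All (_≡ u) ys → All (_≡ t) zs →
  u ≡ s ⊎ u ≡ t → signChanges (xs ++ ys ++ zs) ≤ 1
three-runs {xs = xs} {ys} {zs} ps qs rs (inj₁ refl) =
  subst (λ l → signChanges l ≤ 1) (++-assoc xs ys zs) (two-runs (++⁺ ps qs) rs)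
three-runs ps qs rs (inj₂ refl) = two-runs ps (++⁺ qs rs)

run-pair-run : ∀ {s xs zs} a b → All (_≡ s) xs → a ≡ s ⊎ b ≡ flip s → All (_≡ flip s) zs →
  signChanges (xs ++ a ∷ b ∷ zs) ≤ 1
run-pair-run {s} {xs} {zs} a b ps (inj₁ refl) rs =
  subst (λ l → signChanges l ≤ 1) (++-assoc xs (a ∷ []) (b ∷ zs))
    (three-runs (++⁺ ps (refl ∷ [])) (refl ∷ []) rs (sign-dichotomy b s))
run-pair-run {s} a b ps (inj₂ refl) rs = three-runs ps (refl ∷ []) (refl ∷ rs) (sign-dichotomy a s)

data Resolves : List Col3 → List Sign → Set where
  []  : Resolves [] []
  _∷_ : ∀ {x y L ys} → (x ≡ nul ⊎ x ≡ embed y) → Resolves L ys → Resolves (x ∷ L) (y ∷ ys)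

AtMostOneChange : List Col3 → Set
AtMostOneChange L = ∀ ys → Resolves L ys → signChanges ys ≤ 1

Run : Sign → List Col3 → Set
Run s = All (_≡ embed s)

Steady : List Col3 → Set
Steady L = ∀ {ys} → Resolves L ys → Σ Sign λ s → All (_≡ s) ys

embed-injective : ∀ {a b} → embed a ≡ embed b → a ≡ b
embed-injective {minus} {minus} refl = refl
embed-injective {plus} {plus} refl = refl

embed≢nul : ∀ {s} → embed s ≢ nul
embed≢nul {minus} ()
embed≢nul {plus} ()

resolves-sign : ∀ {s x y} → x ≡ embed s → (x ≡ nul ⊎ x ≡ embed y) → y ≡ s
resolves-sign refl (inj₁ e) = ⊥-elim (embed≢nul e)
resolves-sign refl (inj₂ e) = embed-injective (sym e)

resolves-++ : ∀ L₁ {L₂ ys} → Resolves (L₁ ++ L₂) ys →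
  Σ (List Sign) λ ys₁ → Σ (List Sign) λ ys₂ → ys ≡ ys₁ ++ ys₂ × Resolves L₁ ys₁ × Resolves L₂ ys₂
resolves-++ [] res = [] , _ , refl , [] , res
resolves-++ (x ∷ L₁) (p ∷ res) with resolves-++ L₁ res
... | ys₁ , ys₂ , refl , res₁ , res₂ = _ ∷ ys₁ , ys₂ , refl , p ∷ res₁ , res₂

resolves-run : ∀ {s L ys} → Run s L → Resolves L ys → All (_≡ s) ys
resolves-run [] [] = []
resolves-run (e ∷ run) (p ∷ res) = resolves-sign e p ∷ resolves-run run res

steady-run : ∀ {s L} → Run s L → Steady L
steady-run {s} run res = s , resolves-run run res

steady-short : ∀ {L} → length L ≤ 1 → Steady L
steady-short {[]} _ [] = minus , []
steady-short {_ ∷ []} _ (_∷_ {y = y} _ []) = y , refl ∷ []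
steady-short {_ ∷ _ ∷ _} (s≤s ()) _

steady-steady : ∀ {L₁ L₂} → Steady L₁ → Steady L₂ → AtMostOneChange (L₁ ++ L₂)
steady-steady {L₁} st₁ st₂ ys res with resolves-++ L₁ res
... | ys₁ , ys₂ , refl , res₁ , res₂ = two-runs (proj₂ (st₁ res₁)) (proj₂ (st₂ res₂))

run-run-run : ∀ {s u t L₁ L₂ L₃} → Run s L₁ → Run u L₂ → Run t L₃ → u ≡ s ⊎ u ≡ t →
  AtMostOneChange (L₁ ++ L₂ ++ L₃)
run-run-run {L₁ = L₁} {L₂} run₁ run₂ run₃ u≈ ys res with resolves-++ L₁ res
... | ys₁ , _ , refl , res₁ , res₂₃ with resolves-++ L₂ res₂₃
...   | ys₂ , ys₃ , refl , res₂ , res₃ =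
  three-runs (resolves-run run₁ res₁) (resolves-run run₂ res₂) (resolves-run run₃ res₃) u≈

-- the pair of colours (x , y) never resolves to the step (flip s , s)
Forward : Sign → Col3 → Col3 → Set
Forward s x y = x ≡ embed s ⊎ y ≡ embed (flip s)

run-forward-run : ∀ {s L₁ x y L₃} → Run s L₁ → Forward s x y → Run (flip s) L₃ →
  AtMostOneChange (L₁ ++ x ∷ y ∷ L₃)
run-forward-run {s} {L₁} {x} {y} run₁ fw run₃ ys res with resolves-++ L₁ res
... | ys₁ , a ∷ b ∷ ys₃ , refl , res₁ , px ∷ py ∷ res₃ =
  run-pair-run a b (resolves-run run₁ res₁) (resolved fw) (resolves-run run₃ res₃)
  where
  resolved : Forward s x y → a ≡ s ⊎ b ≡ flip s
  resolved (inj₁ e) = inj₁ (resolves-sign e px)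
  resolved (inj₂ e) = inj₂ (resolves-sign e py)

drop-deletions : ∀ (W₁ V : List ℕ) → drop (length W₁) (deletions (W₁ ++ V)) ≡ map (W₁ ++_) (deletions V)
drop-deletions [] V = sym (map-id (deletions V))
drop-deletions (u ∷ W₁) V = begin
  drop (length W₁) (map (u ∷_) (deletions (W₁ ++ V)))  ≡⟨ drop-map (length W₁) (deletions (W₁ ++ V)) ⟩
  map (u ∷_) (drop (length W₁) (deletions (W₁ ++ V)))  ≡⟨ cong (map (u ∷_)) (drop-deletions W₁ V) ⟩
  map (u ∷_) (map (W₁ ++_) (deletions V))              ≡⟨ sym (map-∘ (deletions V)) ⟩
  map (λ D → u ∷ W₁ ++ D) (deletions V)                ∎
  where open ≡-Reasoning

zipWith-++ : ∀ {A B C : Set} (f : A → B → C) xs ys zs →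
  zipWith f (xs ++ ys) zs ≡ zipWith f xs zs ++ zipWith f ys (drop (length xs) zs)
zipWith-++ f [] ys zs = refl
zipWith-++ f (x ∷ xs) ys [] = sym (zipWith-zeroʳ f ys)
zipWith-++ f (x ∷ xs) ys (z ∷ zs) = cong (f x z ∷_) (zipWith-++ f xs ys zs)

zipWith-self : ∀ {A B : Set} (f : A → A → B) xs → zipWith f xs xs ≡ map (λ x → f x x) xs
zipWith-self f [] = refl
zipWith-self f (x ∷ xs) = cong (f x x ∷_) (zipWith-self f xs)

length-deletions : ∀ (W : List ℕ) → length (deletions W) ≡ length W
length-deletions [] = refl
length-deletions (x ∷ W) = cong suc (trans (length-map (x ∷_) (deletions W)) (length-deletions W))

linked-middle : ∀ {R : ℕ → ℕ → Set} w₁ {v v'} w₂ → Linked R (w₁ ++ v ∷ v' ∷ w₂) → R v v'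
linked-middle [] w₂ (Rvv' ∷ _) = Rvv'
linked-middle (_ ∷ w₁) w₂ linked = linked-middle w₁ w₂ (Lk.tail linked)

deletions-all : ∀ {P : ℕ → Set} B → All P B → All (All P) (deletions B)
deletions-all [] [] = []
deletions-all (x ∷ B) (px ∷ pB) = pB ∷ map⁺ (All.map (px ∷_) (deletions-all B pB))

increasing-above : ∀ {x w} → Linked _<_ (x ∷ w) → All (x <_) w
increasing-above [-] = []
increasing-above (x<y ∷ increasing) = Linked⇒All <-trans x<y increasing

deletions-map : ∀ (f : ℕ → ℕ) w → deletions (map f w) ≡ map (map f) (deletions w)
deletions-map f [] = refl
deletions-map f (x ∷ w) = cong (map f w ∷_) (begin
  map (f x ∷_) (deletions (map f w))      ≡⟨ cong (map (f x ∷_)) (deletions-map f w) ⟩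
  map (f x ∷_) (map (map f) (deletions w)) ≡⟨ sym (map-∘ (deletions w)) ⟩
  map (λ D → f x ∷ map f D) (deletions w)  ≡⟨ map-∘ (deletions w) ⟩
  map (map f) (map (x ∷_) (deletions w))   ∎)
  where open ≡-Reasoning

deletions-edges : ∀ r n w → IsEdge (suc r) n w → All (IsEdge r n) (deletions w)
deletions-edges r n w (len , increasing , bounds) =
  All.zipWith (λ { ((len' , increasing') , bounds') → suc-injective (trans len' len) , increasing' , bounds' })
    (All.zip (lengths w , sorted w increasing) , deletions-all w bounds)
  where
  lengths : ∀ (w : List ℕ) → All (λ D → suc (length D) ≡ length w) (deletions w)
  lengths [] = []
  lengths (x ∷ w) = refl ∷ map⁺ (All.map (cong suc) (lengths w))
  cons : ∀ {x D} → All (x <_) D → Linked _<_ D → Linked _<_ (x ∷ D)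
  cons [] _ = [-]
  cons (x<d ∷ _) sortedD = x<d ∷ sortedD
  sorted : ∀ w → Linked _<_ w → All (Linked _<_) (deletions w)
  sorted [] _ = []
  sorted (x ∷ w) increasing = Lk.tail increasing ∷
    map⁺ (All.zipWith (λ (above , sortedD) → cons above sortedD)
      (deletions-all w (increasing-above increasing) , sorted w (Lk.tail increasing)))

increasing-length : ∀ {a n} x w → Linked _<_ (x ∷ w) → All (λ v → a ≤ v × v < n) (x ∷ w) → length (x ∷ w) + a ≤ n
increasing-length x [] _ ((a≤x , x<n) ∷ []) = <-≤-trans (s≤s a≤x) x<n
increasing-length {a} {n} x (y ∷ w) (x<y ∷ increasing) ((a≤x , _) ∷ bounds) = begin
  suc (length (y ∷ w)) + a   ≡⟨ sym (+-suc (length (y ∷ w)) a) ⟩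
  length (y ∷ w) + suc a     ≤⟨ +-monoʳ-≤ (length (y ∷ w)) (s≤s a≤x) ⟩
  length (y ∷ w) + suc x     ≤⟨ increasing-length y w increasing (All.zipWith (λ { (x<v , (_ , v<n)) → x<v , v<n }) (increasing-above (x<y ∷ increasing) , bounds)) ⟩
  n                          ∎
  where open ≤-Reasoning

T-≡ : ∀ {b} → T b → b ≡ true
T-≡ {true} _ = refl

≡-T : ∀ {b} → b ≡ true → T b
≡-T refl = tt

≡ᵇ-refl : ∀ m → (m ≡ᵇ m) ≡ true
≡ᵇ-refl m = T-≡ (≡⇒≡ᵇ m m refl)

≡ᵇ-false : ∀ {m n} → m ≢ n → (m ≡ᵇ n) ≡ false
≡ᵇ-false {m} {n} m≢n with m ≡ᵇ n in eq
... | true = contradiction (≡ᵇ⇒≡ m n (≡-T eq)) m≢n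
... | false = refl

Positive : List ℕ → Set
Positive = All (1 ≤_)

isEven-suc : ∀ n → isEven (suc n) ≡ not (isEven n)
isEven-suc zero = refl
isEven-suc (suc zero) = refl
isEven-suc (suc (suc n)) = isEven-suc n

altSign : ℕ → Sign
altSign j = if isEven j then minus else plus

altSign-suc : ∀ j → altSign (suc j) ≡ flip (altSign j)
altSign-suc j rewrite isEven-suc j with isEven j
... | true = refl
... | false = refl

-- closed form of the sign of a composition (1,…,1,q,…) with q ≥ 2 and
-- a leading ones: it is altSign (a + 1); here j counts the ones seen plus one
signAfterOnes : ℕ → List ℕ → Maybe Sign
signAfterOnes j (suc (suc _) ∷ _) = just (altSign j)
signAfterOnes j (suc zero ∷ xs) = signAfterOnes (suc j) xs
signAfterOnes j _ = nothing

closedSign : List ℕ → Maybe Sign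
closedSign (suc (suc p) ∷ _ ∷ _) = just (flip (altSign (suc (suc p))))
closedSign (suc zero ∷ xs) = signAfterOnes 2 xs
closedSign _ = nothing

HasSign : Sign → List ℕ → Set
HasSign s σ = Positive σ × closedSign σ ≡ just s

redStep-sum : ∀ σ → Positive σ → σ ≢ [] → sum (redStep σ) < sum σ
redStep-sum [] _ ne = ⊥-elim (ne refl)
redStep-sum (zero ∷ []) (() ∷ _) _
redStep-sum (suc zero ∷ []) _ _ = s≤s z≤n
redStep-sum (suc (suc p) ∷ []) _ _ = ≤-refl
redStep-sum (suc zero ∷ y ∷ xs) (_ ∷ ps) _ = +-monoʳ-< 1 (redStep-sum (y ∷ xs) ps λ ())
redStep-sum (suc (suc p) ∷ y ∷ xs) (_ ∷ ps) _ = +-monoʳ-< (suc (suc p)) (redStep-sum (y ∷ xs) ps λ ())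

redStep-positive : ∀ σ → Positive σ → Positive (redStep σ)
redStep-positive [] ps = ps
redStep-positive (zero ∷ []) (() ∷ _)
redStep-positive (suc zero ∷ []) ps = []
redStep-positive (suc (suc p) ∷ []) ps = s≤s z≤n ∷ []
redStep-positive (suc zero ∷ y ∷ xs) (px ∷ ps) = px ∷ redStep-positive (y ∷ xs) ps
redStep-positive (suc (suc p) ∷ y ∷ xs) (px ∷ ps) = px ∷ redStep-positive (y ∷ xs) ps

signAfterOnes-redStep : ∀ {j s} xs → Positive xs → signAfterOnes j xs ≡ just s →
  onesThenTwo xs ≡ false → signAfterOnes j (redStep xs) ≡ just s
signAfterOnes-redStep (suc (suc (suc q)) ∷ []) _ e _ = e
signAfterOnes-redStep (suc (suc q) ∷ y ∷ ys) _ e _ = e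
signAfterOnes-redStep (suc zero ∷ y ∷ ys) (_ ∷ ps) e o = signAfterOnes-redStep (y ∷ ys) ps e o

closedSign-redStep : ∀ {s} σ → Positive σ → closedSign σ ≡ just s → targetSign σ ≡ nothing →
  closedSign (redStep σ) ≡ just s
closedSign-redStep (suc (suc p) ∷ zero ∷ _) (_ ∷ () ∷ _) _ _
closedSign-redStep (suc (suc p) ∷ suc (suc q) ∷ []) _ e _ = e
closedSign-redStep (suc (suc p) ∷ suc zero ∷ z ∷ zs) _ e _ = e
closedSign-redStep (suc (suc p) ∷ suc (suc y) ∷ z ∷ zs) _ e _ = e
closedSign-redStep (suc zero ∷ y ∷ ys) (_ ∷ ps) e t with onesThenTwo (y ∷ ys) in o
... | false = signAfterOnes-redStep (y ∷ ys) ps e o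

signAfterOnes-onesThenTwo : ∀ j xs → onesThenTwo xs ≡ true →
  signAfterOnes j xs ≡ just (altSign (j + sum xs))
signAfterOnes-onesThenTwo j (suc (suc zero) ∷ []) _ = cong (λ k → just (altSign k)) (+-comm 2 j)
signAfterOnes-onesThenTwo j (suc zero ∷ xs) o =
  trans (signAfterOnes-onesThenTwo (suc j) xs o) (cong (λ k → just (altSign k)) (sym (+-suc j (sum xs))))

targetSign-closedSign : ∀ {s s'} σ → closedSign σ ≡ just s → targetSign σ ≡ just s' → s' ≡ s
targetSign-closedSign (suc (suc p) ∷ suc zero ∷ []) refl refl = begin
  altSign (suc (suc p) + 1)   ≡⟨ cong altSign (+-comm (suc (suc p)) 1) ⟩
  altSign (suc (suc (suc p))) ≡⟨ altSign-suc (suc (suc p)) ⟩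
  flip (altSign (suc (suc p))) ∎
  where open ≡-Reasoning
targetSign-closedSign (suc zero ∷ xs) e t with onesThenTwo xs in o
... | true = just-injective (begin
  just _                                  ≡⟨ sym t ⟩
  just (evenSign (suc (sum xs)))          ≡⟨ cong just (evenSign-suc (sum xs)) ⟩
  just (altSign (2 + sum xs))             ≡⟨ sym (signAfterOnes-onesThenTwo 2 xs o) ⟩
  signAfterOnes 2 xs                      ≡⟨ e ⟩
  just _                                  ∎)
  where
  open ≡-Reasoning
  evenSign : ℕ → Sign
  evenSign n = if isEven n then plus else minus
  evenSign-suc : ∀ n → evenSign (suc n) ≡ altSign n
  evenSign-suc n rewrite isEven-suc n with isEven n
  ... | true = refl
  ... | false = refl

signAux-closedSign : ∀ {s} f σ → HasSign s σ → sum σ ≤ f → signAux f σ ≡ just s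
signAux-closedSign zero (zero ∷ _) (() ∷ _ , _) _
signAux-closedSign zero (suc _ ∷ _) _ ()
signAux-closedSign (suc f) σ (ps , e) le with targetSign σ in t
... | just s' = cong just (targetSign-closedSign σ e t)
... | nothing = signAux-closedSign f (redStep σ)
  (redStep-positive σ ps , closedSign-redStep σ ps e t)
  (≤-pred (≤-trans (redStep-sum σ ps (nonEmpty σ e)) le))
  where
  nonEmpty : ∀ {s} σ → closedSign σ ≡ just s → σ ≢ []
  nonEmpty (_ ∷ _) _ ()

compSign-closedSign : ∀ {s} σ → HasSign s σ → compSign σ ≡ just s
compSign-closedSign σ h = signAux-closedSign (sum σ) σ h ≤-refl

compareColour : ℕ → ℕ → Col3
compareColour e o = if e <ᵇ o then neg else if e ≡ᵇ o then nul else pos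

evenSum oddSum : List ℕ → ℕ
evenSum Y = sum (evenPos Y)
oddSum Y = sum (oddPos Y)

sumColour : List ℕ → Col3
sumColour Y = compareColour (evenSum Y) (oddSum Y)

levelColour : ℕ → (List ℕ → Col3) → List ℕ → List ℕ → Col3
levelColour r prev σ Y with length σ ≡ᵇ 1 | allOnes σ ∧ (length σ ≡ᵇ r)
... | true | _ = prev Y
... | false | true = sumColour Y
... | false | false with compSign σ
...   | just s = embed s
...   | nothing = nul

compareColour-neg : ∀ {e o} → e < o → compareColour e o ≡ neg
compareColour-neg {e} {o} lt rewrite T-≡ (<⇒<ᵇ lt) = refl

compareColour-pos : ∀ {e o} → o < e → compareColour e o ≡ pos
compareColour-pos {e} {o} lt with e <ᵇ o in lt?
... | true = ⊥-elim (<⇒≯ lt (<ᵇ⇒< e o (≡-T lt?)))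
... | false with e ≡ᵇ o in eq?
...   | true = ⊥-elim (<⇒≢ lt (sym (≡ᵇ⇒≡ e o (≡-T eq?))))
...   | false = refl

data Raised : Bool → List ℕ → List ℕ → Set where
  odd-raised  : ∀ {X X'} → evenSum X ≡ evenSum X' → oddSum X < oddSum X' → Raised true X X'
  even-raised : ∀ {X X'} → oddSum X ≡ oddSum X' → evenSum X < evenSum X' → Raised false X X'

raise-entry : ∀ W₁ {x y} W₂ → x < y → Raised (isEven (length W₁)) (W₁ ++ x ∷ W₂) (W₁ ++ y ∷ W₂)
raise-entry [] W₂ lt = odd-raised refl (+-monoˡ-< _ lt)
raise-entry (u ∷ W₁) W₂ lt rewrite isEven-suc (length W₁) with isEven (length W₁) | raise-entry W₁ W₂ lt
... | true | odd-raised e l = even-raised (cong (u +_) e) l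
... | false | even-raised e l = odd-raised e (+-monoʳ-< u l)

-- deleting the smaller rather than the larger of two adjacent vertices never
-- steps back in the sum colour: this is what makes the 0-coloured edges harmless
sumColour-forward : ∀ W₁ {x y} W₂ → x < y →
  Forward (altSign (length W₁)) (sumColour (W₁ ++ y ∷ W₂)) (sumColour (W₁ ++ x ∷ W₂))
sumColour-forward W₁ W₂ lt with isEven (length W₁) | raise-entry W₁ W₂ lt
... | true | odd-raised {X} {X'} e l with evenSum X' <? oddSum X'
...   | yes p = inj₁ (compareColour-neg p)
...   | no p = inj₂ (compareColour-pos (<-≤-trans l (≤-trans (≮⇒≥ p) (≤-reflexive (sym e)))))
sumColour-forward W₁ W₂ lt | false | even-raised {X} {X'} e l with oddSum X' <? evenSum X'
...   | yes p = inj₁ (compareColour-pos p)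
...   | no p = inj₂ (compareColour-neg (<-≤-trans l (≤-trans (≮⇒≥ p) (≤-reflexive (sym e)))))

signAfterOnes-notAllOnes : ∀ {j s} xs → signAfterOnes j xs ≡ just s → allOnes xs ≡ false
signAfterOnes-notAllOnes (suc (suc q) ∷ xs) e = refl
signAfterOnes-notAllOnes (suc zero ∷ xs) e = signAfterOnes-notAllOnes xs e

closedSign-notAllOnes : ∀ {s} σ → closedSign σ ≡ just s → allOnes σ ≡ false
closedSign-notAllOnes (suc (suc p) ∷ _ ∷ _) e = refl
closedSign-notAllOnes (suc zero ∷ xs) e = signAfterOnes-notAllOnes xs e

closedSign-notSingle : ∀ {s} σ → closedSign σ ≡ just s → (length σ ≡ᵇ 1) ≡ false
closedSign-notSingle (suc (suc p) ∷ _ ∷ _) e = refl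
closedSign-notSingle (suc zero ∷ _ ∷ _) e = refl

levelColour-signed : ∀ {s} r prev σ Y → HasSign s σ → levelColour r prev σ Y ≡ embed s
levelColour-signed r prev σ Y (ps , e)
  with length σ ≡ᵇ 1 in single? | allOnes σ ∧ (length σ ≡ᵇ r) in ones?
... | true | _ = contradiction (trans (sym single?) (closedSign-notSingle σ e)) λ ()
... | false | true = contradiction (trans (sym ones?) (cong (_∧ (length σ ≡ᵇ r)) (closedSign-notAllOnes σ e))) λ ()
... | false | false with compSign σ in sign?
...   | just s' = cong embed (just-injective (trans (sym sign?) (compSign-closedSign σ (ps , e))))
...   | nothing = contradiction (trans (sym sign?) (compSign-closedSign σ (ps , e))) λ ()

levelColour-ones : ∀ r prev σ Y → allOnes σ ≡ true → length σ ≡ r → 2 ≤ r →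
  levelColour r prev σ Y ≡ sumColour Y
levelColour-ones r prev σ Y ones refl 2≤r
  with length σ ≡ᵇ 1 in single? | allOnes σ ∧ (length σ ≡ᵇ length σ) in ones?
... | true | _ = ⊥-elim (<⇒≢ 2≤r (sym (≡ᵇ⇒≡ _ _ (≡-T single?))))
... | false | true = refl
... | false | false =
  contradiction (trans (sym ones?) (cong₂ _∧_ ones (≡ᵇ-refl (length σ)))) λ ()

ones : ℕ → List ℕ
ones n = replicate n 1

-- the composition left when one vertex of the first block (of size q) is deleted
decHead : ℕ → List ℕ → List ℕ
decHead (suc (suc q)) τ = suc q ∷ τ
decHead _ τ = τ

-- decs τ lists the compositions of S⁽¹⁾, S⁽²⁾, … for an edge with composition τ:
-- deleting any of the q vertices of the first block gives decHead q τ
decs : List ℕ → List (List ℕ)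
decs [] = []
decs (q ∷ τ) = replicate q (decHead q τ) ++ map (q ∷_) (decs τ)

decs-single : ∀ q → 1 ≤ q → decs (suc q ∷ []) ≡ replicate (suc q) (q ∷ [])
decs-single (suc q) _ = ++-identityʳ _

decs-length : ∀ τ → length (decs τ) ≡ sum τ
decs-length [] = refl
decs-length (q ∷ τ) = begin
  length (replicate q (decHead q τ) ++ map (q ∷_) (decs τ))
    ≡⟨ length-++ (replicate q (decHead q τ)) ⟩
  length (replicate q (decHead q τ)) + length (map (q ∷_) (decs τ))
    ≡⟨ cong₂ _+_ (length-replicate q) (trans (length-map (q ∷_) (decs τ)) (decs-length τ)) ⟩
  q + sum τ ∎
  where open ≡-Reasoning

decs-positive : ∀ τ → Positive τ → All (λ δ → Positive δ × suc (sum δ) ≡ sum τ) (decs τ)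
decs-positive [] [] = []
decs-positive (q ∷ τ) (1≤q ∷ ps) =
  ++⁺ (replicate⁺ q (head-positive q 1≤q)) (map⁺ (All.map extend (decs-positive τ ps)))
  where
  head-positive : ∀ q → 1 ≤ q → Positive (decHead q τ) × suc (sum (decHead q τ)) ≡ q + sum τ
  head-positive (suc zero) _ = ps , refl
  head-positive (suc (suc q)) _ = s≤s z≤n ∷ ps , refl
  extend : ∀ {δ} → Positive δ × suc (sum δ) ≡ sum τ → Positive (q ∷ δ) × suc (q + sum δ) ≡ q + sum τ
  extend (pδ , e) = 1≤q ∷ pδ , trans (sym (+-suc q _)) (cong (q +_) e)

decs-ones : ∀ a X → decs (ones a ++ X) ≡ replicate a (ones (pred a) ++ X) ++ map (ones a ++_) (decs X)
decs-ones zero X = sym (map-id (decs X))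
decs-ones (suc a) X = begin
  (ones a ++ X) ∷ map (1 ∷_) (decs (ones a ++ X))
    ≡⟨ cong (λ u → (ones a ++ X) ∷ map (1 ∷_) u) (decs-ones a X) ⟩
  (ones a ++ X) ∷ map (1 ∷_) (replicate a (ones (pred a) ++ X) ++ map (ones a ++_) (decs X))
    ≡⟨ cong ((ones a ++ X) ∷_) (map-++ (1 ∷_) (replicate a (ones (pred a) ++ X)) _) ⟩
  (ones a ++ X) ∷ (map (1 ∷_) (replicate a (ones (pred a) ++ X)) ++ map (1 ∷_) (map (ones a ++_) (decs X)))
    ≡⟨ cong₂ (λ u v → (ones a ++ X) ∷ (u ++ v)) (trans (map-replicate (1 ∷_) a _) (shift a)) (sym (map-∘ (decs X))) ⟩
  (ones a ++ X) ∷ (replicate a (ones a ++ X) ++ map (ones (suc a) ++_) (decs X)) ∎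
  where
  open ≡-Reasoning
  shift : ∀ a → replicate a (1 ∷ ones (pred a) ++ X) ≡ replicate a (ones a ++ X)
  shift zero = refl
  shift (suc a) = refl

-- the three groups of deletions of an edge with composition (1,…,1,q,τ) (a ones):
-- from the singleton blocks, from the block of size q, and from the later blocks
groupA groupB groupC : ℕ → ℕ → List ℕ → List (List ℕ)
groupA a q τ = replicate a (ones (pred a) ++ q ∷ τ)
groupB a q τ = replicate q (ones a ++ decHead q τ)
groupC a q τ = map (λ δ → ones a ++ q ∷ δ) (decs τ)

decs-groups : ∀ a q τ → decs (ones a ++ q ∷ τ) ≡ groupA a q τ ++ groupB a q τ ++ groupC a q τ
decs-groups a q τ = begin
  decs (ones a ++ q ∷ τ)
    ≡⟨ decs-ones a (q ∷ τ) ⟩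
  groupA a q τ ++ map (ones a ++_) (replicate q (decHead q τ) ++ map (q ∷_) (decs τ))
    ≡⟨ cong (groupA a q τ ++_) (map-++ (ones a ++_) (replicate q (decHead q τ)) _) ⟩
  groupA a q τ ++ map (ones a ++_) (replicate q (decHead q τ)) ++ map (ones a ++_) (map (q ∷_) (decs τ))
    ≡⟨ cong₂ (λ u v → groupA a q τ ++ u ++ v) (map-replicate (ones a ++_) q _) (sym (map-∘ (decs τ))) ⟩
  groupA a q τ ++ groupB a q τ ++ groupC a q τ ∎
  where open ≡-Reasoning

leadSign : ℕ → ℕ → Sign
leadSign zero q = flip (altSign q)
leadSign (suc a) q = altSign (2 + a)

leadSign-two : ∀ a → leadSign a 2 ≡ altSign (suc a)
leadSign-two zero = refl
leadSign-two (suc a) = refl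

ones-positive : ∀ a {X} → Positive X → Positive (ones a ++ X)
ones-positive zero ps = ps
ones-positive (suc a) ps = s≤s z≤n ∷ ones-positive a ps

sum-ones : ∀ a X → sum (ones a ++ X) ≡ a + sum X
sum-ones zero X = refl
sum-ones (suc a) X = cong suc (sum-ones a X)

allOnes-ones : ∀ a X → allOnes (ones a ++ X) ≡ allOnes X
allOnes-ones zero X = refl
allOnes-ones (suc a) X = allOnes-ones a X

allOnes-sum : ∀ σ → allOnes σ ≡ true → sum σ ≡ length σ
allOnes-sum [] _ = refl
allOnes-sum (suc zero ∷ σ) e = cong suc (allOnes-sum σ e)

signAfterOnes-ones : ∀ j n p δ → signAfterOnes j (ones n ++ suc (suc p) ∷ δ) ≡ just (altSign (j + n))
signAfterOnes-ones j zero p δ = cong (λ k → just (altSign k)) (sym (+-identityʳ j))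
signAfterOnes-ones j (suc n) p δ =
  trans (signAfterOnes-ones (suc j) n p δ) (cong (λ k → just (altSign k)) (sym (+-suc j n)))

hasSign-lead : ∀ a p δ → Positive δ → 1 ≤ a + sum δ →
  HasSign (leadSign a (suc (suc p))) (ones a ++ suc (suc p) ∷ δ)
hasSign-lead zero p [] ps ()
hasSign-lead zero p (d ∷ δ) ps _ = (s≤s z≤n ∷ ps) , refl
hasSign-lead (suc a) p δ ps _ = ones-positive (suc a) (s≤s z≤n ∷ ps) , signAfterOnes-ones 2 a p δ

signAfterOnes-defined : ∀ j xs → Positive xs → allOnes xs ≡ false → Σ Sign λ s → signAfterOnes j xs ≡ just s
signAfterOnes-defined j (suc zero ∷ xs) (_ ∷ ps) e = signAfterOnes-defined (suc j) xs ps e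
signAfterOnes-defined j (suc (suc q) ∷ xs) _ _ = altSign j , refl

hasSign-notAllOnes : ∀ a τ → Positive τ → allOnes τ ≡ false → Σ Sign λ s → HasSign s (ones a ++ 1 ∷ τ)
hasSign-notAllOnes zero τ ps e with signAfterOnes-defined 2 τ ps e
... | s , e' = s , (s≤s z≤n ∷ ps) , e'
hasSign-notAllOnes (suc a) τ ps e
  with signAfterOnes-defined 2 (ones a ++ 1 ∷ τ) (ones-positive a (s≤s z≤n ∷ ps)) (trans (allOnes-ones a (1 ∷ τ)) e)
... | s , e' = s , ones-positive (suc a) (s≤s z≤n ∷ ps) , e'

IncreasingAt : ℕ → List ℕ → Set
IncreasingAt a W = Σ (List ℕ) λ W₁ → Σ ℕ λ x → Σ ℕ λ y → Σ (List ℕ) λ W₂ →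
  W ≡ W₁ ++ x ∷ y ∷ W₂ × length W₁ ≡ a × x < y

module DeletionColours (r : ℕ) (prev : List ℕ → Col3) where

  colours : List (List ℕ) → List (List ℕ) → List Col3
  colours = zipWith (levelColour r prev)

  colours-run : ∀ {s} X D → All (HasSign s) X → Run s (colours X D)
  colours-run [] D [] = []
  colours-run (σ ∷ X) [] _ = []
  colours-run (σ ∷ X) (Y ∷ D) (h ∷ hs) = levelColour-signed r prev σ Y h ∷ colours-run X D hs

  colours-steady : ∀ {s} X D → All (HasSign s) X ⊎ length X ≤ 1 → Steady (colours X D)
  colours-steady X D (inj₁ hs) = steady-run (colours-run X D hs)
  colours-steady X D (inj₂ short) =
    steady-short (≤-trans (≤-reflexive (length-zipWith (levelColour r prev) X D)) (≤-trans (m⊓n≤m _ _) short))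

  LA LB LC : ℕ → ℕ → List ℕ → List (List ℕ) → List Col3
  LA a q τ D = colours (groupA a q τ) D
  LB a q τ D = colours (groupB a q τ) (drop (length (groupA a q τ)) D)
  LC a q τ D = colours (groupC a q τ) (drop (length (groupB a q τ)) (drop (length (groupA a q τ)) D))

  colours-groups : ∀ a q τ D → colours (decs (ones a ++ q ∷ τ)) D ≡ LA a q τ D ++ LB a q τ D ++ LC a q τ D
  colours-groups a q τ D = begin
    colours (decs (ones a ++ q ∷ τ)) D
      ≡⟨ cong (λ X → colours X D) (decs-groups a q τ) ⟩
    colours (groupA a q τ ++ groupB a q τ ++ groupC a q τ) D
      ≡⟨ zipWith-++ _ (groupA a q τ) _ D ⟩
    LA a q τ D ++ colours (groupB a q τ ++ groupC a q τ) (drop (length (groupA a q τ)) D)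
      ≡⟨ cong (LA a q τ D ++_) (zipWith-++ _ (groupB a q τ) _ _) ⟩
    LA a q τ D ++ LB a q τ D ++ LC a q τ D ∎
    where open ≡-Reasoning

  groupC-sign : ∀ a p τ → Positive τ → 1 ≤ a ⊎ 2 ≤ sum τ →
    All (HasSign (leadSign a (suc (suc p)))) (groupC a (suc (suc p)) τ)
  groupC-sign a p τ ps big = map⁺ (All.map sign (decs-positive τ ps))
    where
    sign : ∀ {δ} → Positive δ × suc (sum δ) ≡ sum τ → HasSign (leadSign a (suc (suc p))) (ones a ++ suc (suc p) ∷ δ)
    sign {δ} (pδ , e) = hasSign-lead a p δ pδ (twoParts big)
      where
      twoParts : 1 ≤ a ⊎ 2 ≤ sum τ → 1 ≤ a + sum δ
      twoParts (inj₁ 1≤a) = ≤-trans 1≤a (m≤m+n a (sum δ))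
      twoParts (inj₂ 2≤τ) = ≤-trans (≤-pred (subst (2 ≤_) (sym e) 2≤τ)) (m≤n+m (sum δ) a)

  -- a block of size ≥ 3: the deletions from it and from later blocks share a
  -- sign (or the singleton blocks are absent), so two steady runs remain
  long-block : ∀ a p τ D → Positive τ → 1 ≤ a + sum τ →
    AtMostOneChange (colours (decs (ones a ++ suc (suc (suc p)) ∷ τ)) D)
  long-block a p τ D ps nonSingle =
    subst AtMostOneChange (sym (colours-groups a Q τ D)) (runs a nonSingle)
    where
    Q : ℕ
    Q = suc (suc (suc p))
    groupB-sign : ∀ a → 1 ≤ a + sum τ → All (HasSign (leadSign a (suc (suc p)))) (groupB a Q τ)
    groupB-sign a nonSingle = replicate⁺ Q (hasSign-lead a p τ ps nonSingle)
    runs : ∀ a → 1 ≤ a + sum τ → AtMostOneChange (LA a Q τ D ++ LB a Q τ D ++ LC a Q τ D)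
    runs zero nonSingle = steady-steady
      (colours-steady (groupB 0 Q τ) D (inj₁ (groupB-sign 0 nonSingle)))
      (colours-steady (groupC 0 Q τ) _ lastBlocks)
      where
      lastBlocks : All (HasSign (leadSign 0 Q)) (groupC 0 Q τ) ⊎ length (groupC 0 Q τ) ≤ 1
      lastBlocks with 2 ≤? sum τ
      ... | yes 2≤τ = inj₁ (groupC-sign 0 (suc p) τ ps (inj₂ 2≤τ))
      ... | no 2≰τ = inj₂ (begin
        length (groupC 0 Q τ)  ≡⟨ trans (length-map _ (decs τ)) (decs-length τ) ⟩
        sum τ                  ≤⟨ ≤-pred (≰⇒> 2≰τ) ⟩
        1                      ∎)
        where open ≤-Reasoning
    runs (suc a) _ = steady-steady
      (colours-steady (groupA (suc a) Q τ) D firstBlocks)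
      (steady-run (++⁺ (colours-run (groupB (suc a) Q τ) _ (groupB-sign (suc a) (s≤s z≤n)))
                       (colours-run (groupC (suc a) Q τ) _ (groupC-sign (suc a) (suc p) τ ps (inj₁ (s≤s z≤n))))))
      where
      firstBlocks : All (HasSign (leadSign a Q)) (groupA (suc a) Q τ) ⊎ length (groupA (suc a) Q τ) ≤ 1
      firstBlocks with 1 ≤? a + sum τ
      ... | yes nonSingle = inj₁ (replicate⁺ (suc a) (hasSign-lead a (suc p) τ ps nonSingle))
      ... | no single = inj₂ (≤-reflexive (trans (length-replicate (suc a))
                               (cong suc (m+n≡0⇒m≡0 a (n≤0⇒n≡0 (≤-pred (≰⇒> single)))))))

  -- when the distinguished block has size 2, the deletions from the singleton
  -- blocks have sign altSign a and those from later blocks the opposite sign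
  two-first : ∀ a τ D → Positive τ → 2 ≤ a + sum τ → Run (altSign a) (LA a 2 τ D)
  two-first a τ D ps many = colours-run (groupA a 2 τ) D (first a many)
    where
    first : ∀ a → 2 ≤ a + sum τ → All (HasSign (altSign a)) (groupA a 2 τ)
    first zero _ = []
    first (suc a) (s≤s many) =
      replicate⁺ (suc a) (subst (λ s → HasSign s (ones a ++ 2 ∷ τ)) (leadSign-two a) (hasSign-lead a 0 τ ps many))

  two-last : ∀ a τ D → Positive τ → 2 ≤ a + sum τ → Run (flip (altSign a)) (LC a 2 τ D)
  two-last a τ D ps many = colours-run (groupC a 2 τ) _
    (subst (λ s → All (HasSign s) (groupC a 2 τ)) (trans (leadSign-two a) (altSign-suc a)) (groupC-sign a 0 τ ps (big a many)))
    where
    big : ∀ a → 2 ≤ a + sum τ → 1 ≤ a ⊎ 2 ≤ sum τ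
    big zero 2≤τ = inj₂ 2≤τ
    big (suc a) _ = inj₁ (s≤s z≤n)

  pair-colours : ∀ τ W₁ x y W₂ → let σ = ones (length W₁) ++ 1 ∷ τ in
    LB (length W₁) 2 τ (deletions (W₁ ++ x ∷ y ∷ W₂)) ≡
      levelColour r prev σ (W₁ ++ y ∷ W₂) ∷ levelColour r prev σ (W₁ ++ x ∷ W₂) ∷ []
  pair-colours τ W₁ x y W₂ = begin
    colours σσ (drop (length (groupA (length W₁) 2 τ)) (deletions (W₁ ++ x ∷ y ∷ W₂)))
      ≡⟨ cong (λ n → colours σσ (drop n (deletions (W₁ ++ x ∷ y ∷ W₂)))) (length-replicate (length W₁)) ⟩
    colours σσ (drop (length W₁) (deletions (W₁ ++ x ∷ y ∷ W₂)))
      ≡⟨ cong (colours σσ) (drop-deletions W₁ (x ∷ y ∷ W₂)) ⟩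
    colours σσ (map (W₁ ++_) (deletions (x ∷ y ∷ W₂))) ∎
    where
    open ≡-Reasoning
    σσ : List (List ℕ)
    σσ = groupB (length W₁) 2 τ

  -- block of size 2 and only singleton blocks otherwise: the two deletions from
  -- the block leave one vertex in every block, so they get sum colours, which
  -- are Forward by sumColour-forward
  pair-block : ∀ τ W₁ x y W₂ → 2 ≤ r → Positive τ → allOnes τ ≡ true → 2 ≤ length W₁ + sum τ →
    sum (ones (length W₁) ++ 1 ∷ τ) ≡ r → x < y →
    AtMostOneChange (LA (length W₁) 2 τ (deletions (W₁ ++ x ∷ y ∷ W₂)) ++ LB (length W₁) 2 τ (deletions (W₁ ++ x ∷ y ∷ W₂))
                       ++ LC (length W₁) 2 τ (deletions (W₁ ++ x ∷ y ∷ W₂)))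
  pair-block τ W₁ x y W₂ 2≤r ps onesτ many total x<y =
    subst (λ L → AtMostOneChange (LA a 2 τ D ++ L ++ LC a 2 τ D)) (sym (pair-colours τ W₁ x y W₂))
      (run-forward-run (two-first a τ D ps many) forward (two-last a τ D ps many))
    where
    a : ℕ
    a = length W₁
    D : List (List ℕ)
    D = deletions (W₁ ++ x ∷ y ∷ W₂)
    σ : List ℕ
    σ = ones a ++ 1 ∷ τ
    σ-ones : allOnes σ ≡ true
    σ-ones = trans (allOnes-ones a (1 ∷ τ)) onesτ
    σ-length : length σ ≡ r
    σ-length = trans (sym (allOnes-sum σ σ-ones)) total
    forward : Forward (altSign a) (levelColour r prev σ (W₁ ++ y ∷ W₂)) (levelColour r prev σ (W₁ ++ x ∷ W₂))
    forward rewrite levelColour-ones r prev σ (W₁ ++ y ∷ W₂) σ-ones σ-length 2≤r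
                  | levelColour-ones r prev σ (W₁ ++ x ∷ W₂) σ-ones σ-length 2≤r =
      sumColour-forward W₁ W₂ x<y

  -- a block of size 2: the deletions from it have a common sign, except in the
  -- situation of pair-block
  short-block : ∀ a τ W → 3 ≤ r → Positive τ → sum (ones a ++ 2 ∷ τ) ≡ suc r → IncreasingAt a W →
    AtMostOneChange (colours (decs (ones a ++ 2 ∷ τ)) (deletions W))
  short-block a τ W 3≤r ps total increasing =
    subst AtMostOneChange (sym (colours-groups a 2 τ (deletions W))) (middle (allOnes τ) refl increasing)
    where
    total' : sum (ones a ++ 1 ∷ τ) ≡ r
    total' = suc-injective (trans (sym (sum-raise a τ)) total)
      where
      sum-raise : ∀ a τ → sum (ones a ++ 2 ∷ τ) ≡ suc (sum (ones a ++ 1 ∷ τ))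
      sum-raise zero τ = refl
      sum-raise (suc a) τ = cong suc (sum-raise a τ)
    many : 2 ≤ a + sum τ
    many = ≤-pred (subst (3 ≤_) (trans (sym total') (trans (sum-ones a (1 ∷ τ)) (+-suc a (sum τ)))) 3≤r)
    middle : ∀ b → allOnes τ ≡ b → IncreasingAt a W →
      AtMostOneChange (LA a 2 τ (deletions W) ++ LB a 2 τ (deletions W) ++ LC a 2 τ (deletions W))
    middle false notOnes _ with hasSign-notAllOnes a τ ps notOnes
    ... | s , h = run-run-run (two-first a τ _ ps many) (colours-run (groupB a 2 τ) _ (replicate⁺ 2 h))
                    (two-last a τ _ ps many) (sign-dichotomy s (altSign a))
    middle true onesτ (W₁ , x , y , W₂ , refl , refl , x<y) =
      pair-block τ W₁ x y W₂ (≤-trans (n≤1+n 2) 3≤r) ps onesτ many total' x<y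

  mixed-deletions : ∀ a p τ W → 3 ≤ r → Positive τ → sum (ones a ++ suc (suc p) ∷ τ) ≡ suc r →
    1 ≤ a + sum τ → IncreasingAt a W →
    AtMostOneChange (colours (decs (ones a ++ suc (suc p) ∷ τ)) (deletions W))
  mixed-deletions a zero τ W 3≤r ps total _ increasing = short-block a τ W 3≤r ps total increasing
  mixed-deletions a (suc p) τ W _ ps _ nonSingle _ = long-block a p τ (deletions W) ps nonSingle

incHead : List ℕ → List ℕ
incHead [] = 1 ∷ []
incHead (q ∷ τ) = suc q ∷ τ

-- the lengths of the maximal runs of equal consecutive entries; for the
-- (sorted) block indices of an edge this is its composition
runLengths : List ℕ → List ℕ
runLengths [] = []
runLengths (x ∷ []) = 1 ∷ []
runLengths (x ∷ y ∷ ys) = joinRun (x ≟ y) (runLengths (y ∷ ys))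
  where
  joinRun : Dec (x ≡ y) → List ℕ → List ℕ
  joinRun (yes _) τ = incHead τ
  joinRun (no _) τ = 1 ∷ τ

runLengths-same : ∀ y B → runLengths (y ∷ y ∷ B) ≡ incHead (runLengths (y ∷ B))
runLengths-same y B with y ≟ y
... | yes _ = refl
... | no y≢y = contradiction refl y≢y

runLengths-fresh : ∀ {x y} B → x ≢ y → runLengths (x ∷ y ∷ B) ≡ 1 ∷ runLengths (y ∷ B)
runLengths-fresh {x} {y} B x≢y with x ≟ y
... | yes x≡y = contradiction x≡y x≢y
... | no _ = refl

runLengths-∷ : ∀ x B → Σ ℕ λ q → Σ (List ℕ) λ τ → runLengths (x ∷ B) ≡ suc q ∷ τ
runLengths-∷ x [] = 0 , [] , refl
runLengths-∷ x (y ∷ B) with x ≟ y | runLengths-∷ y B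
... | yes _ | q , τ , e rewrite e = suc q , τ , refl
... | no _ | _ = 0 , runLengths (y ∷ B) , refl

runLengths-positive : ∀ B → Positive (runLengths B)
runLengths-positive [] = []
runLengths-positive (x ∷ []) = s≤s z≤n ∷ []
runLengths-positive (x ∷ y ∷ B) with x ≟ y | runLengths-positive (y ∷ B) | runLengths-∷ y B
... | yes _ | ps | q , τ , e rewrite e with ps
...   | _ ∷ ps' = s≤s z≤n ∷ ps'
runLengths-positive (x ∷ y ∷ B) | no _ | ps | _ = s≤s z≤n ∷ ps

runLengths-sum : ∀ B → sum (runLengths B) ≡ length B
runLengths-sum [] = refl
runLengths-sum (x ∷ []) = refl
runLengths-sum (x ∷ y ∷ B) with x ≟ y | runLengths-sum (y ∷ B)
... | yes _ | ih = trans (sum-incHead (runLengths (y ∷ B))) (cong suc ih)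
  where
  sum-incHead : ∀ xs → sum (incHead xs) ≡ suc (sum xs)
  sum-incHead [] = refl
  sum-incHead (q ∷ τ) = refl
... | no _ | ih = cong suc ih

runLengths-least : ∀ x D → All (x <_) D → runLengths (x ∷ D) ≡ 1 ∷ runLengths D
runLengths-least x [] _ = refl
runLengths-least x (d ∷ D) (x<d ∷ _) = runLengths-fresh D (<⇒≢ x<d)

-- the deletions of x ∷ y ∷ B with x < y: deleting x leaves y ∷ B, and every
-- other deletion keeps x as a run of its own
deletions-runLengths-new : ∀ x y B → x < y → Linked _≤_ (y ∷ B) →
  map runLengths (deletions (y ∷ B)) ≡ decs (runLengths (y ∷ B)) →
  map runLengths (deletions (x ∷ y ∷ B)) ≡ decs (runLengths (x ∷ y ∷ B))
deletions-runLengths-new x y B x<y sorted ih = begin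
  runLengths (y ∷ B) ∷ map runLengths (map (x ∷_) (deletions (y ∷ B)))
    ≡⟨ cong (runLengths (y ∷ B) ∷_) (sym (map-∘ (deletions (y ∷ B)))) ⟩
  runLengths (y ∷ B) ∷ map (λ D → runLengths (x ∷ D)) (deletions (y ∷ B))
    ≡⟨ cong (runLengths (y ∷ B) ∷_) (map-cong-local (All.map (runLengths-least x _) (deletions-all (y ∷ B) above))) ⟩
  runLengths (y ∷ B) ∷ map (λ D → 1 ∷ runLengths D) (deletions (y ∷ B))
    ≡⟨ cong (runLengths (y ∷ B) ∷_) (trans (map-∘ (deletions (y ∷ B))) (cong (map (1 ∷_)) ih)) ⟩
  runLengths (y ∷ B) ∷ map (1 ∷_) (decs (runLengths (y ∷ B)))
    ≡⟨ cong decs (sym (runLengths-fresh B (<⇒≢ x<y))) ⟩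
  decs (runLengths (x ∷ y ∷ B)) ∎
  where
  open ≡-Reasoning
  above : All (x <_) (y ∷ B)
  above = All.map (<-≤-trans x<y) (Linked⇒All ≤-trans ≤-refl sorted)

-- the deletions of x ∷ x ∷ B: the first two both give x ∷ B, and every other
-- deletion has its first run grown by one
deletions-runLengths-repeat : ∀ x B → map runLengths (deletions (x ∷ B)) ≡ decs (runLengths (x ∷ B)) →
  map runLengths (deletions (x ∷ x ∷ B)) ≡ decs (runLengths (x ∷ x ∷ B))
deletions-runLengths-repeat x B ih with runLengths-∷ x B
... | q , τ , e = begin
  runLengths (x ∷ B) ∷ runLengths (x ∷ B) ∷ map runLengths (map (x ∷_) (map (x ∷_) (deletions B)))
    ≡⟨ cong (λ u → runLengths (x ∷ B) ∷ runLengths (x ∷ B) ∷ u)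
         (trans (sym (map-∘ (map (x ∷_) (deletions B)))) (sym (map-∘ (deletions B)))) ⟩
  runLengths (x ∷ B) ∷ runLengths (x ∷ B) ∷ map (runLengths ∘ (x ∷_) ∘ (x ∷_)) (deletions B)
    ≡⟨ cong₂ (λ u v → u ∷ u ∷ v) e (trans (map-cong (λ D → runLengths-same x D) (deletions B)) (map-∘ (deletions B))) ⟩
  (suc q ∷ τ) ∷ (suc q ∷ τ) ∷ map incHead (map (runLengths ∘ (x ∷_)) (deletions B))
    ≡⟨ cong (λ u → (suc q ∷ τ) ∷ (suc q ∷ τ) ∷ map incHead u) later ⟩
  (suc q ∷ τ) ∷ (suc q ∷ τ) ∷ map incHead (replicate q (decHead (suc q) τ) ++ map (suc q ∷_) (decs τ))
    ≡⟨ cong (λ u → (suc q ∷ τ) ∷ (suc q ∷ τ) ∷ u) (map-++ incHead (replicate q _) _) ⟩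
  (suc q ∷ τ) ∷ (suc q ∷ τ) ∷ (map incHead (replicate q (decHead (suc q) τ)) ++ map incHead (map (suc q ∷_) (decs τ)))
    ≡⟨ cong₂ (λ u v → (suc q ∷ τ) ∷ (suc q ∷ τ) ∷ (u ++ v)) (trans (map-replicate incHead q _) (grown q)) (sym (map-∘ (decs τ))) ⟩
  decs (incHead (suc q ∷ τ))
    ≡⟨ cong decs (sym (trans (runLengths-same x B) (cong incHead e))) ⟩
  decs (runLengths (x ∷ x ∷ B)) ∎
  where
  open ≡-Reasoning
  later : map (runLengths ∘ (x ∷_)) (deletions B) ≡ replicate q (decHead (suc q) τ) ++ map (suc q ∷_) (decs τ)
  later = trans (map-∘ (deletions B)) (cong (drop 1) (trans ih (cong decs e)))
  grown : ∀ q → replicate q (incHead (decHead (suc q) τ)) ≡ replicate q (suc q ∷ τ)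
  grown zero = refl
  grown (suc q) = refl

deletions-runLengths : ∀ B → Linked _≤_ B → map runLengths (deletions B) ≡ decs (runLengths B)
deletions-runLengths [] _ = refl
deletions-runLengths (x ∷ []) _ = refl
deletions-runLengths (x ∷ y ∷ B) (x≤y ∷ sorted) with m≤n⇒m<n∨m≡n x≤y
... | inj₁ x<y = deletions-runLengths-new x y B x<y sorted (deletions-runLengths (y ∷ B) sorted)
... | inj₂ refl = deletions-runLengths-repeat x B (deletions-runLengths (x ∷ B) sorted)

runLengths-pair : ∀ (f : ℕ → ℕ) w a p τ → runLengths (map f w) ≡ ones a ++ suc (suc p) ∷ τ →
  Σ (List ℕ) λ w₁ → Σ ℕ λ v → Σ ℕ λ v' → Σ (List ℕ) λ w₂ →
    w ≡ w₁ ++ v ∷ v' ∷ w₂ × length w₁ ≡ a × f v ≡ f v'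
runLengths-pair f [] zero p τ ()
runLengths-pair f [] (suc a) p τ ()
runLengths-pair f (v ∷ []) zero p τ ()
runLengths-pair f (v ∷ []) (suc zero) p τ ()
runLengths-pair f (v ∷ []) (suc (suc a)) p τ ()
runLengths-pair f (v ∷ v' ∷ w) a p τ e with f v ≟ f v' | runLengths-∷ (f v') (map f w)
runLengths-pair f (v ∷ v' ∷ w) zero p τ e | yes fv≡fv' | _ = [] , v , v' , w , refl , refl , fv≡fv'
runLengths-pair f (v ∷ v' ∷ w) (suc a) p τ e | yes _ | q , τ' , e' =
  contradiction (trans (sym e) (cong incHead e')) λ ()
runLengths-pair f (v ∷ v' ∷ w) zero p τ () | no _ | _
runLengths-pair f (v ∷ v' ∷ w) (suc a) p τ e | no _ | _
  with runLengths-pair f (v' ∷ w) a p τ (∷-injectiveʳ e)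
... | w₁ , u , u' , w₂ , split , len , fu≡fu' = v ∷ w₁ , u , u' , w₂ , cong (v ∷_) split , cong suc len , fu≡fu'

runLengths-single : ∀ B q → runLengths B ≡ q ∷ [] → Linked _≡_ B
runLengths-single [] q e = []
runLengths-single (x ∷ []) q e = [-]
runLengths-single (x ∷ y ∷ B) q e = step (runLengths-∷ y B) e (runLengths-single (y ∷ B))
  where
  step : Σ ℕ (λ q' → Σ (List ℕ) λ τ → runLengths (y ∷ B) ≡ suc q' ∷ τ) →
    runLengths (x ∷ y ∷ B) ≡ q ∷ [] → (∀ q' → runLengths (y ∷ B) ≡ q' ∷ [] → Linked _≡_ (y ∷ B)) →
    Linked _≡_ (x ∷ y ∷ B)
  step (q' , τ , e') e rec with x ≟ y
  ... | yes x≡y = x≡y ∷ rec (suc q') (trans e' (cong (suc q' ∷_) (∷-injectiveʳ (trans (cong incHead (sym e')) e))))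
  ... | no _ = contradiction (trans (sym e') (∷-injectiveʳ e)) λ ()

data Shape : List ℕ → Set where
  single  : ∀ q → Shape (q ∷ [])
  allOne  : ∀ {σ} → allOnes σ ≡ true → Shape σ
  mixed   : ∀ a p τ → Positive τ → 1 ≤ a + sum τ → Shape (ones a ++ suc (suc p) ∷ τ)

shape : ∀ σ → Positive σ → Shape σ
shape [] _ = allOne refl
shape (zero ∷ _) (() ∷ _)
shape (suc (suc p) ∷ []) _ = single _
shape (suc (suc p) ∷ t ∷ τ) (_ ∷ 1≤t ∷ ps) = mixed 0 p (t ∷ τ) (1≤t ∷ ps) (≤-trans 1≤t (m≤m+n t (sum τ)))
shape (suc zero ∷ σ) (_ ∷ ps) with shape σ ps
... | single zero = contradiction (All.head ps) λ ()
... | single (suc zero) = allOne refl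
... | single (suc (suc p)) = mixed 1 p [] [] ≤-refl
... | allOne ones = allOne ones
... | mixed a p τ psτ nonSingle = mixed (suc a) p τ psτ (≤-trans nonSingle (n≤1+n _))

count : List ℕ → ℕ → ℕ
count B i = sum (map (λ b → if b ≡ᵇ i then 1 else 0) B)

count-above : ∀ {i} B → All (i <_) B → count B i ≡ 0
count-above [] [] = refl
count-above (b ∷ B) (i<b ∷ above) rewrite ≡ᵇ-false (>⇒≢ i<b) = count-above B above

count-same : ∀ b B → count (b ∷ B) b ≡ suc (count B b)
count-same b B rewrite ≡ᵇ-refl b = refl

count-below : ∀ {b} B I → All (b <_) I → map (count (b ∷ B)) I ≡ map (count B) I
count-below {b} B I above = map-cong-local (All.map unchanged above)
  where
  unchanged : ∀ {i} → b < i → count (b ∷ B) i ≡ count B i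
  unchanged b<i rewrite ≡ᵇ-false (<⇒≢ b<i) = refl

range : ℕ → ℕ → List ℕ
range a zero = []
range a (suc k) = a ∷ range (suc a) k

range-above : ∀ a k → All (a ≤_) (range a k)
range-above a zero = []
range-above a (suc k) = ≤-refl ∷ All.map (≤-trans (n≤1+n a)) (range-above (suc a) k)

upTo-range : ∀ r → upTo r ≡ range 0 r
upTo-range r = shifted 0 r (λ _ → refl)
  where
  shifted : ∀ a k {f : ℕ → ℕ} → (∀ i → f i ≡ a + i) → applyUpTo f k ≡ range a k
  shifted a zero _ = refl
  shifted a (suc k) f≗ = cong₂ _∷_ (trans (f≗ 0) (+-identityʳ a)) (shifted (suc a) k (λ i → trans (f≗ (suc i)) (+-suc a i)))

nonzero : List ℕ → List ℕ
nonzero = filter (λ p → 1 ≤? p)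

firstRun-counts : ∀ b B (later : List ℕ) → Linked _≤_ (b ∷ B) → ∀ c → count B b ≡ c →
  nonzero (c ∷ later) ≡ runLengths B → suc c ∷ nonzero later ≡ runLengths (b ∷ B)
firstRun-counts b [] later _ .0 refl ih = cong (1 ∷_) ih
firstRun-counts b (d ∷ B) later (b≤d ∷ sorted) c counted ih with m≤n⇒m<n∨m≡n b≤d
... | inj₁ b<d with refl ← trans (sym counted) (count-above (d ∷ B) (All.map (<-≤-trans b<d) (Linked⇒All ≤-trans ≤-refl sorted))) =
  trans (cong (1 ∷_) ih) (sym (runLengths-fresh B (<⇒≢ b<d)))
... | inj₂ refl with refl ← trans (sym counted) (count-same b B) =
  trans (cong incHead ih) (sym (runLengths-same b B))

-- inductive step for runLengths-counts: the first count is either 0 (a < b),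
-- or the length of the first run (a = b)
counts-step : ∀ b B a k → Linked _≤_ (b ∷ B) → All (λ c → a ≤ c × c < a + suc k) (b ∷ B) →
  (All (λ c → suc a ≤ c × c < suc a + k) (b ∷ B) → nonzero (map (count (b ∷ B)) (range (suc a) k)) ≡ runLengths (b ∷ B)) →
  nonzero (map (count B) (range a (suc k))) ≡ runLengths B →
  nonzero (map (count (b ∷ B)) (range a (suc k))) ≡ runLengths (b ∷ B)
counts-step b B a k sorted bounds skip ih with m≤n⇒m<n∨m≡n (proj₁ (All.head bounds))
... | inj₁ a<b =
  trans (cong (λ c → nonzero (c ∷ map (count (b ∷ B)) (range (suc a) k))) (count-above (b ∷ B) above))
        (skip (All.zipWith shift (bounds , above)))
  where
  above : All (a <_) (b ∷ B)
  above = All.map (<-≤-trans a<b) (Linked⇒All ≤-trans ≤-refl sorted)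
  shift : ∀ {c} → (a ≤ c × c < a + suc k) × a < c → suc a ≤ c × c < suc a + k
  shift {c} ((_ , c<a+1+k) , a<c) = a<c , subst (c <_) (+-suc a k) c<a+1+k
... | inj₂ refl =
  trans (cong₂ (λ c xs → nonzero (c ∷ xs)) (count-same b B) (count-below B (range (suc b) k) (range-above (suc b) k)))
        (firstRun-counts b B _ sorted (count B b) refl ih)

runLengths-counts : ∀ B a k → Linked _≤_ B → All (λ b → a ≤ b × b < a + k) B →
  nonzero (map (count B) (range a k)) ≡ runLengths B
runLengths-counts [] a zero _ _ = refl
runLengths-counts (b ∷ B) a zero _ ((a≤b , b<a+0) ∷ _) =
  contradiction (subst (b <_) (+-identityʳ a) b<a+0) (≤⇒≯ a≤b)
runLengths-counts [] a (suc k) _ _ = runLengths-counts [] (suc a) k [] []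
runLengths-counts (b ∷ B) a (suc k) sorted bounds =
  counts-step b B a k sorted bounds (runLengths-counts (b ∷ B) (suc a) k sorted)
    (runLengths-counts B a (suc k) (Lk.tail sorted) (All.tail bounds))

-- vertex v ≥ 1 lies in the block with 0-based index blockOf m v (blocks of size m),
-- at position shiftOf m v ∈ [1, m] inside it
blockOf : ℕ → ℕ → ℕ
blockOf m v = divN (v ∸ 1) m

shiftOf : ℕ → ℕ → ℕ
shiftOf m v = v ∸ blockOf m v * m

blockOf-< : ∀ {r m v} → 1 ≤ m → 1 ≤ v → v ≤ r * m → blockOf m v < r
blockOf-< {r} {suc m} {suc u} _ _ v≤rm = m<n*o⇒m/o<n {u} {r} {suc m} v≤rm

blockOf-mono : ∀ m {v v'} → v ≤ v' → blockOf m v ≤ blockOf m v'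
blockOf-mono zero _ = z≤n
blockOf-mono (suc m) v≤v' = /-monoˡ-≤ (suc m) (∸-monoˡ-≤ 1 v≤v')

shiftOf-suc : ∀ m u → shiftOf (suc m) (suc u) ≡ suc (u % suc m)
shiftOf-suc m u = trans (+-∸-assoc 1 (m/n*n≤m u (suc m))) (cong suc (sym (m%n≡m∸m/n*n u (suc m))))

shiftOf-bounds : ∀ {m v} → 1 ≤ m → 1 ≤ v → 1 ≤ shiftOf m v × shiftOf m v ≤ m
shiftOf-bounds {suc m} {suc u} _ _ rewrite shiftOf-suc m u = s≤s z≤n , m%n<n u (suc m)

shiftOf-mono : ∀ {m v v'} → 1 ≤ m → v < v' → blockOf m v ≡ blockOf m v' → shiftOf m v < shiftOf m v'
shiftOf-mono {suc m} {zero} {suc u'} _ _ _ rewrite shiftOf-suc m u' = s≤s z≤n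
shiftOf-mono {suc m} {suc u} {suc u'} _ (s≤s u<u') sameBlock
  rewrite shiftOf-suc m u | shiftOf-suc m u' =
  s≤s (+-cancelʳ-< ((u' / suc m) * suc m) (u % suc m) (u' % suc m)
        (subst (λ z → u % suc m + z * suc m < u' % suc m + (u' / suc m) * suc m) sameBlock
          (subst₂ _<_ (m≡m%n+[m/n]*n u (suc m)) (m≡m%n+[m/n]*n u' (suc m)) u<u')))

blockCount : ℕ → List ℕ → ℕ → ℕ
blockCount m e i = sum (map (λ v → if blockOf m v ≡ᵇ i then 1 else 0) e)

composition : ℕ → ℕ → List ℕ → List ℕ
composition r m e = nonzero (map (blockCount m e) (upTo r))

cStep-level : ∀ r k prev e →
  cStep r k prev e ≡ levelColour r prev (composition r (r ^ suc k) e) (map (shiftOf (r ^ suc k)) e)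
cStep-level r k prev e
  with length (composition r (r ^ suc k) e) ≡ᵇ 1 | allOnes (composition r (r ^ suc k) e) ∧ (length (composition r (r ^ suc k) e) ≡ᵇ r)
... | true | _ = refl
... | false | true = refl
... | false | false with compSign (composition r (r ^ suc k) e)
...   | just s = refl
...   | nothing = refl

blockCount-count : ∀ m e i → blockCount m e i ≡ count (map (blockOf m) e) i
blockCount-count m [] i = refl
blockCount-count m (v ∷ e) i = cong ((if blockOf m v ≡ᵇ i then 1 else 0) +_) (blockCount-count m e i)

composition-runLengths : ∀ r m e → 1 ≤ m → Linked _<_ e → All (λ v → 1 ≤ v × v ≤ r * m) e →
  composition r m e ≡ runLengths (map (blockOf m) e)
composition-runLengths r m e 1≤m increasing bounds = begin
  nonzero (map (blockCount m e) (upTo r))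
    ≡⟨ cong nonzero (map-cong (blockCount-count m e) (upTo r)) ⟩
  nonzero (map (count (map (blockOf m) e)) (upTo r))
    ≡⟨ cong (λ is → nonzero (map (count (map (blockOf m) e)) is)) (upTo-range r) ⟩
  nonzero (map (count (map (blockOf m) e)) (range 0 r))
    ≡⟨ runLengths-counts (map (blockOf m) e) 0 r (Lkₚ.map⁺ (Lk.map (λ v<v' → blockOf-mono m (<⇒≤ v<v')) increasing))
         (map⁺ (All.map (λ { (1≤v , v≤rm) → z≤n , blockOf-< 1≤m 1≤v v≤rm }) bounds)) ⟩
  runLengths (map (blockOf m) e) ∎
  where open ≡-Reasoning

composition-length : ∀ r m e → length (composition r m e) ≤ r
composition-length r m e = begin
  length (nonzero (map (blockCount m e) (upTo r)))  ≤⟨ length-filter (λ p → 1 ≤? p) (map (blockCount m e) (upTo r)) ⟩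
  length (map (blockCount m e) (upTo r))            ≡⟨ length-map _ (upTo r) ⟩
  length (upTo r)                                   ≡⟨ length-upTo r ⟩
  r                                                 ∎
  where open ≤-Reasoning

DeletionsMonotone : ℕ → ℕ → Set
DeletionsMonotone r h = ∀ w → IsEdge (suc r) (r ^ h) w → AtMostOneChange (map (cRH r h) (deletions w))

module LevelStep (r k : ℕ) (3≤r : 3 ≤ r) where

  m : ℕ
  m = r ^ suc k

  1≤m : 1 ≤ m
  1≤m = m^n>0 r {{>-nonZero (≤-trans (s≤s z≤n) 3≤r)}} (suc k)

  open DeletionColours r (cRH r (suc k))

  blocks shifts : List ℕ → List ℕ
  blocks = map (blockOf m)
  shifts = map (shiftOf m)

  deletion-colours : ∀ w → IsEdge (suc r) (r * m) w →
    map (cRH r (suc (suc k))) (deletions w) ≡ colours (decs (runLengths (blocks w))) (deletions (shifts w))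
  deletion-colours w edge = begin
    map (cRH r (suc (suc k))) (deletions w)
      ≡⟨ map-cong-local (All.map byComposition (deletions-edges r (r * m) w edge)) ⟩
    map (λ S → levelColour r _ (runLengths (blocks S)) (shifts S)) (deletions w)
      ≡⟨ sym (zipWith-self (λ S S' → levelColour r _ (runLengths (blocks S)) (shifts S')) (deletions w)) ⟩
    zipWith (λ S S' → levelColour r _ (runLengths (blocks S)) (shifts S')) (deletions w) (deletions w)
      ≡⟨ sym (zipWith-map (levelColour r _) (runLengths ∘ blocks) shifts (deletions w) (deletions w)) ⟩
    colours (map (runLengths ∘ blocks) (deletions w)) (map shifts (deletions w))
      ≡⟨ cong₂ colours (map-∘ (deletions w)) (sym (deletions-map (shiftOf m) w)) ⟩
    colours (map runLengths (map blocks (deletions w))) (deletions (shifts w))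
      ≡⟨ cong (λ X → colours (map runLengths X) (deletions (shifts w))) (sym (deletions-map (blockOf m) w)) ⟩
    colours (map runLengths (deletions (blocks w))) (deletions (shifts w))
      ≡⟨ cong (λ X → colours X (deletions (shifts w))) (deletions-runLengths (blocks w) blocksSorted) ⟩
    colours (decs (runLengths (blocks w))) (deletions (shifts w)) ∎
    where
    open ≡-Reasoning
    byComposition : ∀ {S} → IsEdge r (r * m) S → cRH r (suc (suc k)) S ≡ levelColour r _ (runLengths (blocks S)) (shifts S)
    byComposition {S} (_ , increasing , bounds) =
      trans (cStep-level r k _ S) (cong (λ σ → levelColour r _ σ (shifts S)) (composition-runLengths r m S 1≤m increasing bounds))
    blocksSorted : Linked _≤_ (blocks w)
    blocksSorted = Lkₚ.map⁺ (Lk.map (λ v<v' → blockOf-mono m (<⇒≤ v<v')) (proj₁ (proj₂ edge)))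

  shifts-edge : ∀ {n} w → IsEdge n (r * m) w → Linked (λ u v → blockOf m u ≡ blockOf m v) w →
    IsEdge n m (shifts w)
  shifts-edge w (len , increasing , bounds) sameBlock =
    trans (length-map (shiftOf m) w) len ,
    Lkₚ.map⁺ (Lk.zipWith (λ (v<v' , same) → shiftOf-mono 1≤m v<v' same) (increasing , sameBlock)) ,
    map⁺ (All.map (λ (1≤v , _) → shiftOf-bounds 1≤m 1≤v) bounds)

  blocks-total : ∀ w → IsEdge (suc r) (r * m) w → sum (runLengths (blocks w)) ≡ suc r
  blocks-total w (len , _) = trans (runLengths-sum (blocks w)) (trans (length-map (blockOf m) w) len)

  one-block : DeletionsMonotone r (suc k) → ∀ w q → IsEdge (suc r) (r * m) w → runLengths (blocks w) ≡ q ∷ [] →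
    AtMostOneChange (colours (decs (q ∷ [])) (deletions (shifts w)))
  one-block ih w q edge oneRun with trans (sym (+-identityʳ q)) (trans (cong sum (sym oneRun)) (blocks-total w edge))
  ... | refl = subst AtMostOneChange (sym previous)
    (ih (shifts w) (shifts-edge w edge (Lkₚ.map⁻ (runLengths-single (blocks w) (suc r) oneRun))))
    where
    singletons : ∀ n D → length D ≡ n → colours (replicate n (r ∷ [])) D ≡ map (cRH r (suc k)) D
    singletons zero [] _ = refl
    singletons (suc n) (Y ∷ D) len = cong (cRH r (suc k) Y ∷_) (singletons n D (suc-injective len))
    previous : colours (decs (suc r ∷ [])) (deletions (shifts w)) ≡ map (cRH r (suc k)) (deletions (shifts w))
    previous = trans (cong (λ X → colours X (deletions (shifts w))) (decs-single r (≤-trans (s≤s z≤n) 3≤r)))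
      (singletons (suc r) _ (trans (length-deletions (shifts w)) (trans (length-map (shiftOf m) w) (proj₁ edge))))

  -- an (r+1)-edge meets at most r blocks, so its composition is not all ones
  not-all-ones : ∀ w → IsEdge (suc r) (r * m) w → allOnes (runLengths (blocks w)) ≡ true → ⊥
  not-all-ones w edge@(_ , increasing , bounds) ones = <⇒≱ ≤-refl (begin
    suc r                              ≡⟨ sym (blocks-total w edge) ⟩
    sum (runLengths (blocks w))        ≡⟨ allOnes-sum (runLengths (blocks w)) ones ⟩
    length (runLengths (blocks w))     ≡⟨ cong length (sym (composition-runLengths r m w 1≤m increasing bounds)) ⟩
    length (composition r m w)         ≤⟨ composition-length r m w ⟩
    r                                  ∎)
    where open ≤-Reasoning

  -- the vertices at positions a+1, a+2 of an edge whose composition is (1,…,1,q,…)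
  -- (a ones, q ≥ 2) lie in one block, so their shifts increase
  mixed-block : ∀ w a p τ → IsEdge (suc r) (r * m) w → runLengths (blocks w) ≡ ones a ++ suc (suc p) ∷ τ →
    Positive τ → 1 ≤ a + sum τ → AtMostOneChange (colours (decs (ones a ++ suc (suc p) ∷ τ)) (deletions (shifts w)))
  mixed-block w a p τ edge@(_ , increasing , _) composed ps nonSingle =
    mixed-deletions a p τ (shifts w) 3≤r ps (trans (cong sum (sym composed)) (blocks-total w edge)) nonSingle increasingAt
    where
    increasingAt : IncreasingAt a (shifts w)
    increasingAt with runLengths-pair (blockOf m) w a p τ composed
    ... | w₁ , v , v' , w₂ , split , len₁ , sameBlock =
      shifts w₁ , shiftOf m v , shiftOf m v' , shifts w₂ ,
      trans (cong shifts split) (map-++ (shiftOf m) w₁ (v ∷ v' ∷ w₂)) ,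
      trans (length-map (shiftOf m) w₁) len₁ ,
      shiftOf-mono 1≤m (linked-middle w₁ w₂ (subst (Linked _<_) split increasing)) sameBlock

  step : DeletionsMonotone r (suc k) → DeletionsMonotone r (suc (suc k))
  step ih w edge =
    subst AtMostOneChange (sym (deletion-colours w edge)) (byShape _ refl (shape _ (runLengths-positive (blocks w))))
    where
    byShape : ∀ σ → runLengths (blocks w) ≡ σ → Shape σ → AtMostOneChange (colours (decs σ) (deletions (shifts w)))
    byShape _ composed (single q) = one-block ih w q edge composed
    byShape _ composed (allOne ones) = ⊥-elim (not-all-ones w edge (trans (cong allOnes composed) ones))
    byShape _ composed (mixed a p τ ps nonSingle) = mixed-block w a p τ edge composed ps nonSingle

-- level 1: there are no r+1 vertices in [r]
level-one : ∀ r → DeletionsMonotone r 1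
level-one r [] (() , _)
level-one r (x ∷ w) (len , increasing , bounds) = ⊥-elim (<⇒≱ ≤-refl (begin
  suc (suc r)            ≡⟨ +-comm 1 (suc r) ⟩
  suc r + 1              ≡⟨ cong (_+ 1) (sym len) ⟩
  length (x ∷ w) + 1     ≤⟨ increasing-length x w increasing (All.map (λ (1≤v , v≤r) → 1≤v , s≤s v≤r) bounds) ⟩
  suc (r ^ 1)            ≡⟨ cong suc (*-identityʳ r) ⟩
  suc r                  ∎))
  where open ≤-Reasoning

deletionsMonotone : ∀ r → 3 ≤ r → ∀ h → 1 ≤ h → DeletionsMonotone r h
deletionsMonotone r 3≤r (suc zero) _ = level-one r
deletionsMonotone r 3≤r (suc (suc k)) _ = LevelStep.step r k 3≤r (deletionsMonotone r 3≤r (suc k) (s≤s z≤n))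

lemma4p1 : (h r : ℕ) → 1 ≤ h → 3 ≤ r → (c : List ℕ → Sign) →
    Completes r (r ^ h) c (cRH r h) → Monotone r (r ^ h) c
lemma4p1 h r 1≤h 3≤r c completes w edge =
  subst (_≤ 1) (sym (signChanges-reverse (map c (deletions w))))
    (deletionsMonotone r 3≤r h 1≤h w edge (map c (deletions w))
      (resolution (deletions w) (deletions-edges r (r ^ h) w edge)))
  where
  resolution : ∀ Ds → All (IsEdge r (r ^ h)) Ds → Resolves (map (cRH r h) Ds) (map c Ds)
  resolution [] [] = []
  resolution (S ∷ Ds) (edge ∷ edges) = completes S edge ∷ resolution Ds edges
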